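{- Let $p$ be a prime, $n\geq4$, and let $L=D\oplus M$ be an even lattice of level $p$ and signature $(n,2)$, where $D$ is a positive definite even lattice of level $p$ and rank $n-2$ and $M\cong U(p)\oplus U(p)$. If the quadratic space $L/pL'$ over $\mathbb{F}_p$ represents $0\in\mathbb{F}_p$ non-trivially, then for every $m\in p\mathbb{Z}$ there exists $\lambda\in L$ with $Q(\lambda)=m$ and $\lambda/p\notin L'$; moreover, such a $\lambda$ can be chosen to be primitive in $L'$.
   Context: $U(p)$ is $\mathbb{Z}^2$ with quadratic form $(x_1,x_2)\mapsto px_1x_2$. Bilinear form $(x,y)=Q(x+y)-Q(x)-Q(y)$; $L'$ is the dual lattice; since $L$ has level $p$, $pL'\subset L$ and $L/pL'$ is an $\mathbb{F}_p$-vector space on which $Q$ mod $p$ induces a non-degenerate $\mathbb{F}_p$-valued quadratic form. "Represents $0$ non-trivially" means there is $x\in L\setminus pL'$ with $Q(x)\in p\mathbb{Z}$. -}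

module Defs where

open import Data.Nat as ℕ using (ℕ; zero; suc)
open import Data.Integer as ℤ using (ℤ; +_; _+_; _*_; _<_)
open import Data.Integer.Divisibility using (_∣_)
open import Data.Integer.DivMod using (_/_)
open import Data.Fin using (Fin; zero; suc; splitAt)
open import Data.Sum using (inj₁; inj₂)
open import Data.Product using (_×_; ∃)
open import Relation.Binary.PropositionalEquality using (_≡_)
open import Relation.Nullary using (¬_)

-- A lattice of rank r is ℤ^r equipped with its Gram matrix G (G i j = (e_i , e_j)).
Gram : ℕ → Set
Gram r = Fin r → Fin r → ℤ

Vect : ℕ → Set
Vect r = Fin r → ℤ

sumFin : ∀ {r} → (Fin r → ℤ) → ℤ
sumFin {zero}  f = + 0
sumFin {suc r} f = f zero + sumFin (λ i → f (suc i))

B : ∀ {r} → Gram r → Vect r → Vect r → ℤ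
B G x y = sumFin (λ i → sumFin (λ j → x i * G i j * y j))

-- quadratic form Q(x) = (x , x) / 2  (exact for even lattices)
Q : ∀ {r} → Gram r → Vect r → ℤ
Q G x = B G x x / + 2

IsEven : ∀ {r} → Gram r → Set
IsEven G = (∀ i j → G i j ≡ G j i) × (∀ i → + 2 ∣ G i i)

IsZeroVec : ∀ {r} → Vect r → Set
IsZeroVec x = ∀ i → x i ≡ + 0

PositiveDefinite : ∀ {r} → Gram r → Set
PositiveDefinite G = ∀ x → ¬ IsZeroVec x → + 0 < Q G x

-- z / d ∈ L'  (for z ∈ L, d ≥ 1):  (z , x) ∈ d ℤ for all x ∈ L
ScaledInDual : ∀ {r} → Gram r → ℕ → Vect r → Set
ScaledInDual G d z = ∀ x → + d ∣ B G z x

-- N · Q(L') ⊆ ℤ.  Every element of L' ⊂ L ⊗ ℚ is z/d with z ∈ L, d ≥ 1,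
-- and Q(z/d) = Q(z)/d².
LevelDivides : ∀ {r} → Gram r → ℕ → Set
LevelDivides {r} G N = ∀ (d : ℕ) (z : Vect r) → 1 ℕ.≤ d → ScaledInDual G d z →
                   + (d ℕ.* d) ∣ (+ N * Q G z)

HasLevel : ∀ {r} → Gram r → ℕ → Set
HasLevel G N = 1 ℕ.≤ N × LevelDivides G N
             × (∀ M → 1 ℕ.≤ M → M ℕ.< N → ¬ LevelDivides G M)

_⊕_ : ∀ {r s} → Gram r → Gram s → Gram (r ℕ.+ s)
_⊕_ {r} G H i j with splitAt r i | splitAt r j
... | inj₁ a | inj₁ b = G a b
... | inj₂ a | inj₂ b = H a b
... | _      | _      = + 0

U : ℕ → Gram 2
U p zero    zero    = + 0
U p zero    (suc _) = + p
U p (suc _) zero    = + p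
U p (suc _) (suc _) = + 0

PrimitiveInDual : ∀ {r} → Gram r → Vect r → Set
PrimitiveInDual G v = ∀ k → 2 ℕ.≤ k → ¬ ScaledInDual G k v

RepresentsZeroModP : ∀ {r} → Gram r → ℕ → Set
RepresentsZeroModP G p = ∃ λ x → ¬ ScaledInDual G p x × (+ p ∣ Q G x)

-- Let L = D ⊕ (U(p) ⊕ E).  Every value of the bilinear form on the U(p)-block
-- is divisible by p, so changing only the U(p)-coordinates of a vector x
-- neither moves it into nor out of pL'.  Replacing those coordinates by (1, t)
-- changes Q by p·(t − x₁x₂), which can be made any multiple of p; and a vector
-- with first U(p)-coordinate 1 pairs to exactly p with the second basis vector
-- of U(p), which, p being prime, forces it to be primitive in L' unless it lies
-- in pL'.
module Submission where

open import Defs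
open import Data.Nat as ℕ using (ℕ; _≤_; _∸_; _+_)
import Data.Nat.Properties as ℕP
open import Data.Nat.Primality using (Prime; prime⇒irreducible)
open import Data.Integer as ℤ using (ℤ; +_; _-_) renaming (_+_ to _+ℤ_; _*_ to _*ℤ_; suc to sucℤ)
import Data.Integer.Properties as ℤP
import Data.Integer.DivMod as ℤD
open import Data.Integer.DivMod using (_/_)
open import Data.Integer.Divisibility using (_∣_)
import Data.Integer.Divisibility.Signed as ℤS
open import Data.Integer.Tactic.RingSolver using (solve-∀)
open import Data.Fin using (Fin; zero; suc; splitAt; _↑ˡ_; _↑ʳ_)
import Data.Fin.Properties as FinP
open import Data.Sum using (inj₁; inj₂; [_,_]′)
open import Data.Sum.Properties using ([,]-∘; [,]-cong)
open import Data.Product using (_×_; ∃; _,_; proj₁; proj₂)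
open import Relation.Binary.PropositionalEquality
open import Relation.Binary.Definitions using (tri<; tri≈; tri>)
open import Relation.Nullary using (¬_)
open import Data.Empty using (⊥; ⊥-elim)

-- Integer division by a positive d: the quotient is the unique q with
-- q·d ≤ a < (q+1)·d, hence adding a multiple c·d to a adds c to a / d.
-- This is what relates Q = B/2 to the bilinear form.
module _ (d : ℕ) .{{_ : ℕ.NonZero d}} where

  -- if q < q′ then (q+1)·d ≤ q′·d, so q′·d ≤ a < (q+1)·d is impossible
  separated : ∀ a q q′ → q ℤ.< q′ → q′ *ℤ + d ℤ.≤ a → a ℤ.< sucℤ q *ℤ + d → ⊥
  separated a q q′ q<q′ lo′ hi = ℤP.<-irrefl refl
    (ℤP.≤-<-trans (ℤP.≤-trans (ℤP.*-monoʳ-≤-nonNeg (+ d) (ℤP.i<j⇒suc[i]≤j q<q′)) lo′) hi)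

  quotient-unique : ∀ a q q′ → q *ℤ + d ℤ.≤ a → a ℤ.< sucℤ q *ℤ + d →
                    q′ *ℤ + d ℤ.≤ a → a ℤ.< sucℤ q′ *ℤ + d → q ≡ q′
  quotient-unique a q q′ lo hi lo′ hi′ with ℤP.<-cmp q q′
  ... | tri≈ _ q≡q′ _ = q≡q′
  ... | tri< q<q′ _ _ = ⊥-elim (separated a q q′ q<q′ lo′ hi)
  ... | tri> _ _ q′<q = ⊥-elim (separated a q′ q q′<q lo hi′)

  quotient-below : ∀ a → (a / + d) *ℤ + d ℤ.≤ a
  quotient-below a = ℤD.[n/d]*d≤n a (+ d)

  quotient-above : ∀ a → a ℤ.< sucℤ (a / + d) *ℤ + d
  quotient-above a =
    subst (λ q → a ℤ.< sucℤ q *ℤ + d) (sym (ℤD.div-pos-is-/ℕ a d)) (ℤD.n<s[n/ℕd]*d a d)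

  /-shift : ∀ a c → (a +ℤ c *ℤ + d) / + d ≡ a / + d +ℤ c
  /-shift a c = sym (quotient-unique (a +ℤ c *ℤ + d) (a / + d +ℤ c) ((a +ℤ c *ℤ + d) / + d)
    (subst (ℤ._≤ a +ℤ c *ℤ + d) (sym (ℤP.*-distribʳ-+ (+ d) (a / + d) c))
           (ℤP.+-monoˡ-≤ (c *ℤ + d) (quotient-below a)))
    (subst (a +ℤ c *ℤ + d ℤ.<_) (sym shifted-suc)
           (ℤP.+-monoˡ-< (c *ℤ + d) (quotient-above a)))
    (quotient-below _) (quotient-above _))
    where
    shifted-suc : sucℤ (a / + d +ℤ c) *ℤ + d ≡ sucℤ (a / + d) *ℤ + d +ℤ c *ℤ + d
    shifted-suc = trans (cong (_*ℤ + d) (sym (ℤP.+-assoc (+ 1) (a / + d) c)))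
                        (ℤP.*-distribʳ-+ (+ d) (sucℤ (a / + d)) c)

sumFin-cong : ∀ {r} {f g : Fin r → ℤ} → (∀ i → f i ≡ g i) → sumFin f ≡ sumFin g
sumFin-cong {ℕ.zero}  f≗g = refl
sumFin-cong {ℕ.suc r} f≗g = cong₂ _+ℤ_ (f≗g zero) (sumFin-cong (λ i → f≗g (suc i)))

sumFin-zero : ∀ {r} (f : Fin r → ℤ) → (∀ i → f i ≡ + 0) → sumFin f ≡ + 0
sumFin-zero {ℕ.zero}  f f≗0 = refl
sumFin-zero {ℕ.suc r} f f≗0 =
  cong₂ _+ℤ_ (f≗0 zero) (sumFin-zero (λ i → f (suc i)) (λ i → f≗0 (suc i)))

sumFin-+ : ∀ {r} (f g : Fin r → ℤ) → sumFin (λ i → f i +ℤ g i) ≡ sumFin f +ℤ sumFin g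
sumFin-+ {ℕ.zero}  f g = refl
sumFin-+ {ℕ.suc r} f g = begin
  (f zero +ℤ g zero) +ℤ sumFin (λ i → f (suc i) +ℤ g (suc i))
    ≡⟨ cong ((f zero +ℤ g zero) +ℤ_) (sumFin-+ (λ i → f (suc i)) (λ i → g (suc i))) ⟩
  (f zero +ℤ g zero) +ℤ (sumFin (λ i → f (suc i)) +ℤ sumFin (λ i → g (suc i)))
    ≡⟨ interchange (f zero) (g zero) _ _ ⟩
  (f zero +ℤ sumFin (λ i → f (suc i))) +ℤ (g zero +ℤ sumFin (λ i → g (suc i))) ∎
  where
  open ≡-Reasoning
  interchange : ∀ a b c e → (a +ℤ b) +ℤ (c +ℤ e) ≡ (a +ℤ c) +ℤ (b +ℤ e)
  interchange = solve-∀

sumFin-split : ∀ r s (f : Fin (r ℕ.+ s) → ℤ) →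
               sumFin f ≡ sumFin (λ a → f (a ↑ˡ s)) +ℤ sumFin (λ b → f (r ↑ʳ b))
sumFin-split ℕ.zero    s f = sym (ℤP.+-identityˡ _)
sumFin-split (ℕ.suc r) s f =
  trans (cong (f zero +ℤ_) (sumFin-split r s (λ i → f (suc i))))
        (sym (ℤP.+-assoc (f zero) _ _))

doubleSum-blocks : ∀ r s (f : Fin (r ℕ.+ s) → Fin (r ℕ.+ s) → ℤ) →
  sumFin (λ i → sumFin (f i))
  ≡ (sumFin (λ a → sumFin (λ a′ → f (a ↑ˡ s) (a′ ↑ˡ s))) +ℤ
     sumFin (λ b → sumFin (λ a′ → f (r ↑ʳ b) (a′ ↑ˡ s))))
    +ℤ (sumFin (λ a → sumFin (λ b′ → f (a ↑ˡ s) (r ↑ʳ b′))) +ℤ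
        sumFin (λ b → sumFin (λ b′ → f (r ↑ʳ b) (r ↑ʳ b′))))
doubleSum-blocks r s f =
  trans (sumFin-cong (λ i → sumFin-split r s (f i)))
  (trans (sumFin-+ (λ i → sumFin (λ a′ → f i (a′ ↑ˡ s))) (λ i → sumFin (λ b′ → f i (r ↑ʳ b′))))
         (cong₂ _+ℤ_ (sumFin-split r s _) (sumFin-split r s _)))

left : ∀ {r s} → Vect (r ℕ.+ s) → Vect r
left {s = s} x a = x (a ↑ˡ s)

right : ∀ {r s} → Vect (r ℕ.+ s) → Vect s
right {r} x b = x (r ↑ʳ b)

glue : ∀ {r s} → Vect r → Vect s → Vect (r ℕ.+ s)
glue {r} y z i = [ y , z ]′ (splitAt r i)

left-glue : ∀ {r s} (y : Vect r) (z : Vect s) a → left (glue y z) a ≡ y a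
left-glue {r} {s} y z a = cong [ y , z ]′ (FinP.splitAt-↑ˡ r a s)

right-glue : ∀ {r s} (y : Vect r) (z : Vect s) b → right {r} (glue y z) b ≡ z b
right-glue {r} {s} y z b = cong [ y , z ]′ (FinP.splitAt-↑ʳ r s b)

glue-congʳ : ∀ {r s} (y : Vect r) {z z′ : Vect s} → (∀ b → z b ≡ z′ b) →
             ∀ i → glue y z i ≡ glue y z′ i
glue-congʳ {r} y z≗z′ i = [,]-cong (λ _ → refl) z≗z′ (splitAt r i)

glue-parts : ∀ {r s} (x : Vect (r ℕ.+ s)) i → glue (left x) (right {r} x) i ≡ x i
glue-parts {r} {s} x i = trans (sym ([,]-∘ x (splitAt r i))) (cong x (FinP.join-splitAt r s i))

B-cong : ∀ {r} (G : Gram r) {x x′ y y′ : Vect r} →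
         (∀ i → x i ≡ x′ i) → (∀ i → y i ≡ y′ i) → B G x y ≡ B G x′ y′
B-cong G x≗x′ y≗y′ =
  sumFin-cong (λ i → sumFin-cong (λ j → cong₂ (λ a b → a *ℤ G i j *ℤ b) (x≗x′ i) (y≗y′ j)))

B-zeroʳ : ∀ {r} (G : Gram r) (x y : Vect r) → (∀ i → y i ≡ + 0) → B G x y ≡ + 0
B-zeroʳ G x y y≗0 = sumFin-zero _ (λ i → sumFin-zero _ (λ j →
  trans (cong (x i *ℤ G i j *ℤ_) (y≗0 j)) (ℤP.*-zeroʳ (x i *ℤ G i j))))

⊕-ll : ∀ {r s} (G : Gram r) (H : Gram s) a a′ → (G ⊕ H) (a ↑ˡ s) (a′ ↑ˡ s) ≡ G a a′
⊕-ll {r} {s} G H a a′ rewrite FinP.splitAt-↑ˡ r a s | FinP.splitAt-↑ˡ r a′ s = refl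

⊕-lr : ∀ {r s} (G : Gram r) (H : Gram s) a b′ → (G ⊕ H) (a ↑ˡ s) (r ↑ʳ b′) ≡ + 0
⊕-lr {r} {s} G H a b′ rewrite FinP.splitAt-↑ˡ r a s | FinP.splitAt-↑ʳ r s b′ = refl

⊕-rl : ∀ {r s} (G : Gram r) (H : Gram s) b a′ → (G ⊕ H) (r ↑ʳ b) (a′ ↑ˡ s) ≡ + 0
⊕-rl {r} {s} G H b a′ rewrite FinP.splitAt-↑ʳ r s b | FinP.splitAt-↑ˡ r a′ s = refl

⊕-rr : ∀ {r s} (G : Gram r) (H : Gram s) b b′ → (G ⊕ H) (r ↑ʳ b) (r ↑ʳ b′) ≡ H b b′
⊕-rr {r} {s} G H b b′ rewrite FinP.splitAt-↑ʳ r s b | FinP.splitAt-↑ʳ r s b′ = refl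

B-⊕ : ∀ {r s} (G : Gram r) (H : Gram s) (x y : Vect (r ℕ.+ s)) →
      B (G ⊕ H) x y ≡ B G (left x) (left y) +ℤ B H (right {r} x) (right {r} y)
B-⊕ {r} {s} G H x y =
  trans (doubleSum-blocks r s entry)
  (trans (cong₂ _+ℤ_ (cong₂ _+ℤ_ diagonalˡ (offDiagonal (⊕-rl G H)))
                     (cong₂ _+ℤ_ (offDiagonal (⊕-lr G H)) diagonalʳ))
         (cong₂ _+ℤ_ (ℤP.+-identityʳ (B G (left x) (left y)))
                     (ℤP.+-identityˡ (B H (right {r} x) (right {r} y)))))
  where
  open ≡-Reasoning
  entry : Fin (r ℕ.+ s) → Fin (r ℕ.+ s) → ℤ
  entry i j = x i *ℤ (G ⊕ H) i j *ℤ y j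
  diagonalˡ : sumFin (λ a → sumFin (λ a′ → entry (a ↑ˡ s) (a′ ↑ˡ s))) ≡ B G (left x) (left y)
  diagonalˡ = sumFin-cong (λ a → sumFin-cong (λ a′ →
    cong (λ g → x (a ↑ˡ s) *ℤ g *ℤ y (a′ ↑ˡ s)) (⊕-ll G H a a′)))
  diagonalʳ : sumFin (λ b → sumFin (λ b′ → entry (r ↑ʳ b) (r ↑ʳ b′))) ≡ B H (right {r} x) (right {r} y)
  diagonalʳ = sumFin-cong (λ b → sumFin-cong (λ b′ →
    cong (λ g → x (r ↑ʳ b) *ℤ g *ℤ y (r ↑ʳ b′)) (⊕-rr G H b b′)))
  offDiagonal : ∀ {m n} {ι : Fin m → Fin (r ℕ.+ s)} {κ : Fin n → Fin (r ℕ.+ s)} →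
                (∀ i j → (G ⊕ H) (ι i) (κ j) ≡ + 0) → sumFin (λ i → sumFin (λ j → entry (ι i) (κ j))) ≡ + 0
  offDiagonal {ι = ι} {κ} block≡0 = sumFin-zero _ (λ i → sumFin-zero _ (λ j →
    begin
      x (ι i) *ℤ (G ⊕ H) (ι i) (κ j) *ℤ y (κ j) ≡⟨ cong (λ g → x (ι i) *ℤ g *ℤ y (κ j)) (block≡0 i j) ⟩
      x (ι i) *ℤ + 0 *ℤ y (κ j)                 ≡⟨ cong (_*ℤ y (κ j)) (ℤP.*-zeroʳ (x (ι i))) ⟩
      + 0 *ℤ y (κ j)                             ≡⟨ ℤP.*-zeroˡ (y (κ j)) ⟩
      + 0 ∎))

pair : ℤ → ℤ → Vect 2
pair a b zero    = a
pair a b (suc _) = b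

hyperbolicPairing : Vect 2 → Vect 2 → ℤ
hyperbolicPairing u u′ = u zero *ℤ u′ (suc zero) +ℤ u (suc zero) *ℤ u′ zero

B-U : ∀ p (u u′ : Vect 2) → B (U p) u u′ ≡ + p *ℤ hyperbolicPairing u u′
B-U p u u′ = expand (+ p) (u zero) (u (suc zero)) (u′ zero) (u′ (suc zero))
  where
  -- the left-hand side is B (U p) written out as a sum over Fin 2 × Fin 2
  expand : ∀ P a₁ a₂ b₁ b₂ →
    (a₁ *ℤ + 0 *ℤ b₁ +ℤ (a₁ *ℤ P *ℤ b₂ +ℤ + 0)) +ℤ ((a₂ *ℤ P *ℤ b₁ +ℤ (a₂ *ℤ + 0 *ℤ b₂ +ℤ + 0)) +ℤ + 0)
    ≡ P *ℤ (a₁ *ℤ b₂ +ℤ a₂ *ℤ b₁)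
  expand = solve-∀

B-U-divisible : ∀ p (u u′ : Vect 2) → + p ℤS.∣ B (U p) u u′
B-U-divisible p u u′ =
  subst (+ p ℤS.∣_) (sym (B-U p u u′)) (ℤS.∣m⇒∣m*n (hyperbolicPairing u u′) ℤS.∣-refl)

-- A vector v ∉ pL' pairing to exactly p with some e ∈ L is primitive in L':
-- if v/k ∈ L' then k divides (v, e) = p, so k = 1 or k = p.
primitive-if-pairs-to-prime : ∀ {r} (G : Gram r) {p} → Prime p → (v e : Vect r) →
  ¬ ScaledInDual G p v → B G v e ≡ + p → PrimitiveInDual G v
primitive-if-pairs-to-prime G p-prime v e v∉pL′ ve≡p k 2≤k v/k∈L′
  with prime⇒irreducible p-prime (subst (+ k ∣_) ve≡p (v/k∈L′ e))
... | inj₁ refl = ℕP.<-irrefl refl 2≤k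
... | inj₂ refl = v∉pL′ v/k∈L′

module ReplaceHyperbolicBlock {r s : ℕ} (p : ℕ) (A : Gram r) (E : Gram s) where

  L : Gram (r ℕ.+ (2 ℕ.+ s))
  L = A ⊕ (U p ⊕ E)

  partA : Vect (r ℕ.+ (2 ℕ.+ s)) → Vect r
  partA = left

  partU : Vect (r ℕ.+ (2 ℕ.+ s)) → Vect 2
  partU x = left (right {r} x)

  partE : Vect (r ℕ.+ (2 ℕ.+ s)) → Vect s
  partE x = right {2} (right {r} x)

  replaceU : Vect 2 → Vect (r ℕ.+ (2 ℕ.+ s)) → Vect (r ℕ.+ (2 ℕ.+ s))
  replaceU u x = glue (partA x) (glue u (partE x))

  replaceU-own : ∀ x i → replaceU (partU x) x i ≡ x i
  replaceU-own x i = trans (glue-congʳ (partA x) (glue-parts {2} (right {r} x)) i) (glue-parts {r} x i)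

  B-blocks : ∀ x y → B L x y ≡ B A (partA x) (partA y) +ℤ
                               (B (U p) (partU x) (partU y) +ℤ B E (partE x) (partE y))
  B-blocks x y = trans (B-⊕ A (U p ⊕ E) x y)
                       (cong (B A (partA x) (partA y) +ℤ_) (B-⊕ (U p) E (right {r} x) (right {r} y)))

  B-blocks-replaceU : ∀ u u′ x y →
    B L (replaceU u x) (replaceU u′ y) ≡ B A (partA x) (partA y) +ℤ
                                         (B (U p) u u′ +ℤ B E (partE x) (partE y))
  B-blocks-replaceU u u′ x y = trans (B-blocks (replaceU u x) (replaceU u′ y))
    (cong₂ _+ℤ_ (B-cong A (left-glue _ _) (left-glue _ _))
                (cong₂ _+ℤ_ (B-cong (U p) (partU-glue u x) (partU-glue u′ y))
                            (B-cong E (partE-glue u x) (partE-glue u′ y))))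
    where
    partU-glue : ∀ u x b → partU (replaceU u x) b ≡ u b
    partU-glue u x b = trans (right-glue (partA x) (glue u (partE x)) (b ↑ˡ s)) (left-glue u (partE x) b)
    partE-glue : ∀ u x b → partE (replaceU u x) b ≡ partE x b
    partE-glue u x b = trans (right-glue (partA x) (glue u (partE x)) (2 ↑ʳ b)) (right-glue u (partE x) b)

  -- The U(p)-block lies in pL', so replacing it does not change membership
  -- in pL': if (replaceU u x)/p ∈ L' then x/p ∈ L'.
  scaled-replaceU : ∀ u x → ScaledInDual L p (replaceU u x) → ScaledInDual L p x
  scaled-replaceU u x v/p∈L′ z = ℤS.∣⇒∣ᵤ (subst (+ p ℤS.∣_) (sym (B-blocks x z))
    (subst (+ p ℤS.∣_) (exchange pairingA (B (U p) u (partU z)) pairingU pairingE)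
      (ℤS.∣m∣n⇒∣m+n p∣vz (ℤS.∣m∣n⇒∣m-n (B-U-divisible p (partU x) (partU z)) (B-U-divisible p u (partU z))))))
    where
    pairingA pairingU pairingE : ℤ
    pairingA = B A (partA x) (partA z)
    pairingU = B (U p) (partU x) (partU z)
    pairingE = B E (partE x) (partE z)
    p∣vz : + p ℤS.∣ pairingA +ℤ (B (U p) u (partU z) +ℤ pairingE)
    p∣vz = ℤS.∣ᵤ⇒∣ (subst (+ p ∣_)
      (trans (B-cong L {x = replaceU u x} (λ _ → refl) (λ i → sym (replaceU-own z i))) (B-blocks-replaceU u (partU z) x z))
      (v/p∈L′ z))
    exchange : ∀ a b c e → (a +ℤ (b +ℤ e)) +ℤ (c - b) ≡ a +ℤ (c +ℤ e)
    exchange = solve-∀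

  Q-replaceU : ∀ u x → Q L (replaceU u x) ≡
    Q L x +ℤ + p *ℤ (u zero *ℤ u (suc zero) - partU x zero *ℤ partU x (suc zero))
  Q-replaceU u x = begin
    B L (replaceU u x) (replaceU u x) / + 2
      ≡⟨ cong (_/ + 2) B-difference ⟩
    (B L x x +ℤ + p *ℤ (u₁ *ℤ u₂ - x₁ *ℤ x₂) *ℤ + 2) / + 2
      ≡⟨ /-shift 2 (B L x x) (+ p *ℤ (u₁ *ℤ u₂ - x₁ *ℤ x₂)) ⟩
    Q L x +ℤ + p *ℤ (u₁ *ℤ u₂ - x₁ *ℤ x₂) ∎
    where
    open ≡-Reasoning
    u₁ u₂ x₁ x₂ : ℤ
    u₁ = u zero
    u₂ = u (suc zero)
    x₁ = partU x zero
    x₂ = partU x (suc zero)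
    rearrange : ∀ a e P u₁ u₂ x₁ x₂ → a +ℤ (P *ℤ (u₁ *ℤ u₂ +ℤ u₂ *ℤ u₁) +ℤ e)
      ≡ (a +ℤ (P *ℤ (x₁ *ℤ x₂ +ℤ x₂ *ℤ x₁) +ℤ e)) +ℤ P *ℤ (u₁ *ℤ u₂ - x₁ *ℤ x₂) *ℤ + 2
    rearrange = solve-∀
    B-difference : B L (replaceU u x) (replaceU u x) ≡ B L x x +ℤ + p *ℤ (u₁ *ℤ u₂ - x₁ *ℤ x₂) *ℤ + 2
    B-difference = begin
      B L (replaceU u x) (replaceU u x)
        ≡⟨ B-blocks-replaceU u u x x ⟩
      a +ℤ (B (U p) u u +ℤ e)
        ≡⟨ cong (λ h → a +ℤ (h +ℤ e)) (B-U p u u) ⟩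
      a +ℤ (+ p *ℤ hyperbolicPairing u u +ℤ e)
        ≡⟨ rearrange a e (+ p) u₁ u₂ x₁ x₂ ⟩
      (a +ℤ (+ p *ℤ hyperbolicPairing (partU x) (partU x) +ℤ e)) +ℤ δ *ℤ + 2
        ≡⟨ cong (λ h → (a +ℤ (h +ℤ e)) +ℤ δ *ℤ + 2) (sym (B-U p (partU x) (partU x))) ⟩
      (a +ℤ (B (U p) (partU x) (partU x) +ℤ e)) +ℤ δ *ℤ + 2
        ≡⟨ cong (_+ℤ δ *ℤ + 2) (sym (B-blocks x x)) ⟩
      B L x x +ℤ δ *ℤ + 2 ∎
      where
      a e δ : ℤ
      a = B A (partA x) (partA x)
      e = B E (partE x) (partE x)
      δ = + p *ℤ (u₁ *ℤ u₂ - x₁ *ℤ x₂)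

  basisU : Vect (r ℕ.+ (2 ℕ.+ s))
  basisU = replaceU (pair (+ 0) (+ 1)) (λ _ → + 0)

  B-replaceU-basisU : ∀ u x → B L (replaceU u x) basisU ≡ + p *ℤ u zero
  B-replaceU-basisU u x = begin
    B L (replaceU u x) basisU
      ≡⟨ B-blocks-replaceU u (pair (+ 0) (+ 1)) x (λ _ → + 0) ⟩
    B A (partA x) (λ _ → + 0) +ℤ (B (U p) u (pair (+ 0) (+ 1)) +ℤ B E (partE x) (λ _ → + 0))
      ≡⟨ cong₂ _+ℤ_ (B-zeroʳ A (partA x) _ (λ _ → refl))
           (cong₂ _+ℤ_ (B-U p u (pair (+ 0) (+ 1))) (B-zeroʳ E (partE x) _ (λ _ → refl))) ⟩
    + 0 +ℤ (+ p *ℤ (u zero *ℤ + 1 +ℤ u (suc zero) *ℤ + 0) +ℤ + 0)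
      ≡⟨ simplify (+ p) (u zero) (u (suc zero)) ⟩
    + p *ℤ u zero ∎
    where
    open ≡-Reasoning
    simplify : ∀ P u₁ u₂ → + 0 +ℤ (P *ℤ (u₁ *ℤ + 1 +ℤ u₂ *ℤ + 0) +ℤ + 0) ≡ P *ℤ u₁
    simplify = solve-∀

  -- Every multiple m of p is Q of x with U(p)-component replaced by (1, t) for
  -- a suitable t, provided p divides Q(x): take t = x₁x₂ + (m − Q(x))/p.
  represents-multiples : ∀ x m → + p ∣ Q L x → + p ∣ m → ∃ λ t → Q L (replaceU (pair (+ 1) t) x) ≡ m
  represents-multiples x m p∣Qx p∣m = t , (begin
      Q L (replaceU (pair (+ 1) t) x)  ≡⟨ Q-replaceU (pair (+ 1) t) x ⟩
      Q L x +ℤ + p *ℤ (+ 1 *ℤ t - x₁ *ℤ x₂)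
        ≡⟨ cong (_+ℤ + p *ℤ (+ 1 *ℤ t - x₁ *ℤ x₂)) (ℤS._∣_.equality Qx-quotient) ⟩
      Qx/p *ℤ + p +ℤ + p *ℤ (+ 1 *ℤ t - x₁ *ℤ x₂)  ≡⟨ cancel (+ p) Qx/p m/p (x₁ *ℤ x₂) ⟩
      m/p *ℤ + p                                  ≡⟨ sym (ℤS._∣_.equality m-quotient) ⟩
      m ∎)
    where
    open ≡-Reasoning
    x₁ x₂ : ℤ
    x₁ = partU x zero
    x₂ = partU x (suc zero)
    Qx-quotient : + p ℤS.∣ Q L x
    Qx-quotient = ℤS.∣ᵤ⇒∣ p∣Qx
    m-quotient : + p ℤS.∣ m
    m-quotient = ℤS.∣ᵤ⇒∣ p∣m
    Qx/p m/p t : ℤ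
    Qx/p = ℤS._∣_.quotient Qx-quotient
    m/p = ℤS._∣_.quotient m-quotient
    t = x₁ *ℤ x₂ +ℤ (m/p - Qx/p)
    cancel : ∀ P k l c → k *ℤ P +ℤ P *ℤ (+ 1 *ℤ (c +ℤ (l - k)) - c) ≡ l *ℤ P
    cancel = solve-∀

-- Lemma 6.8.  Take x ∉ pL' with p ∣ Q(x) and replace its first U(p)-component
-- by (1, t) so that Q becomes m; the result stays outside pL' and pairs to p
-- with the second basis vector of the first U(p), hence is primitive in L'.
lemma6p8 : (p : ℕ) → Prime p → (n : ℕ) → 4 ≤ n →
    (D : Gram (n ∸ 2)) → IsEven D → PositiveDefinite D → HasLevel D p →
    HasLevel (D ⊕ (U p ⊕ U p)) p →
    RepresentsZeroModP (D ⊕ (U p ⊕ U p)) p →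
    (m : ℤ) → + p ∣ m →
    ∃ λ (v : Vect ((n ∸ 2) + 4)) →
    Q (D ⊕ (U p ⊕ U p)) v ≡ m
    × ¬ ScaledInDual (D ⊕ (U p ⊕ U p)) p v
    × PrimitiveInDual (D ⊕ (U p ⊕ U p)) v
lemma6p8 p p-prime n _ D _ _ _ _ (x , x∉pL′ , p∣Qx) m p∣m =
  v , Qv≡m , v∉pL′ ,
  primitive-if-pairs-to-prime L p-prime v basisU v∉pL′
    (trans (B-replaceU-basisU (pair (+ 1) t) x) (ℤP.*-identityʳ (+ p)))
  where
  open ReplaceHyperbolicBlock p D (U p)
  t : ℤ
  t = proj₁ (represents-multiples x m p∣Qx p∣m)
  v : Vect ((n ∸ 2) + 4)
  v = replaceU (pair (+ 1) t) x
  Qv≡m : Q L v ≡ m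
  Qv≡m = proj₂ (represents-multiples x m p∣Qx p∣m)
  v∉pL′ : ¬ ScaledInDual L p v
  v∉pL′ v/p∈L′ = x∉pL′ (scaled-replaceU (pair (+ 1) t) x v/p∈L′)
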